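{- Let $v$ be a positive even integer such that $v/2$ is an odd prime. Let $(A,B)$ be a periodic Golay pair of length $v$, let $a=\sum_i a_i$ and $b=\sum_i b_i$ be the sums of the entries of $A$ and $B$ (so that $a^2+b^2=2v$), and let $(A^{(v/2)},B^{(v/2)})$ be its $(v/2)$-compression. Then $(A^{(v/2)},B^{(v/2)})$ is equivalent to $\bigl([\tfrac{a+b}{2},\tfrac{a-b}{2}],[\tfrac{a+b}{2},\tfrac{b-a}{2}]\bigr)$.
   Context: A periodic Golay pair of length $v$ is a pair of sequences $A=[a_0,\dots,a_{v-1}]$, $B=[b_0,\dots,b_{v-1}]$ with all entries in $\{ -1,+1\}$ such that $\mathrm{PAF}(A,s)+\mathrm{PAF}(B,s)=0$ for $s=1,\dots,v/2$, where $\mathrm{PAF}(A,s)=\sum_{k=0}^{v-1}a_ka_{k+s}$ with indices modulo $v$. For a positive divisor $m$ of $v$, the $m$-compression of $A$ is the length-$v/m$ sequence $A^{(m)}$ with entries $a^{(m)}_k=\sum_{j=0}^{m-1}a_{k+j\,v/m}$; the $m$-compression of $(A,B)$ is $(A^{(m)},B^{(m)})$. Equivalence of pairs $(X,Y)$ of integer sequences of a common length $n$ is the equivalence relation generated by the operations: swapping $X$ and $Y$; cyclically shifting the entries of one of the sequences; reversing one of the sequences; decimation, replacing $x_i$ by $x_{ki \bmod n}$ and $y_i$ by $y_{ki\bmod n}$ for some $k$ coprime to $n$; alternating negation, replacing $x_i$ by $(-1)^ix_i$ and $y_i$ by $(-1)^iy_i$ (the negation of one sequence is obtainable from these). -}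

module Defs where

open import Data.Nat as ℕ using (ℕ; zero; suc)
open import Data.Nat.DivMod using (_%_; m%n<n)
open import Data.Nat.Coprimality using (Coprime)
open import Data.Integer as ℤ using (ℤ; +_; -_; 0ℤ; 1ℤ; -1ℤ)
open import Data.Fin using (Fin; zero; suc; toℕ; fromℕ<; opposite)
open import Data.Product using (_×_; _,_)
open import Relation.Binary.PropositionalEquality using (_≡_)

Seq : ℕ → Set
Seq n = Fin n → ℤ

at : ∀ {n} → Seq n → ℕ → ℤ
at {zero}  X k = 0ℤ
at {suc n} X k = X (fromℕ< (m%n<n k (suc n)))

sumTo : ℕ → (ℕ → ℤ) → ℤ
sumTo zero    f = 0ℤ
sumTo (suc n) f = sumTo n f ℤ.+ f n

seqSum : ∀ {n} → Seq n → ℤ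
seqSum {n} X = sumTo n (at X)

IsBinary : ∀ {n} → Seq n → Set
IsBinary X = ∀ i → X i ≡ 1ℤ Data.Sum.⊎ X i ≡ -1ℤ
  where import Data.Sum

PAF : ∀ {n} → Seq n → ℕ → ℤ
PAF {n} X s = sumTo n (λ k → at X k ℤ.* at X (k ℕ.+ s))

IsPeriodicGolayPair : (v : ℕ) → Seq v → Seq v → Set
IsPeriodicGolayPair v A B =
  IsBinary A × IsBinary B ×
  (∀ s → 1 ℕ.≤ s → s ℕ.≤ v Data.Nat.DivMod./ 2 → PAF A s ℤ.+ PAF B s ≡ 0ℤ)
  where import Data.Nat.DivMod

-- m-compression of a sequence of length v = m * l (so v/m = l):
-- entry k (k < l) is Σ_{j<m} x_{k + j l}
compress : (m l : ℕ) → Seq (m ℕ.* l) → Seq l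
compress m l X k = sumTo m (λ j → at X (toℕ k ℕ.+ j ℕ.* l))

Pair : ℕ → Set
Pair n = Seq n × Seq n

altSign : ℕ → ℤ
altSign zero          = 1ℤ
altSign (suc zero)    = -1ℤ
altSign (suc (suc i)) = altSign i

data Equiv {n : ℕ} : Pair n → Pair n → Set where
  pointwise : ∀ {X Y X′ Y′} → (∀ i → X i ≡ X′ i) → (∀ i → Y i ≡ Y′ i) →
              Equiv (X , Y) (X′ , Y′)
  swap      : ∀ {X Y} → Equiv (X , Y) (Y , X)
  shift₁    : ∀ {X Y} (t : ℕ) → Equiv (X , Y) ((λ i → at X (toℕ i ℕ.+ t)) , Y)
  shift₂    : ∀ {X Y} (t : ℕ) → Equiv (X , Y) (X , (λ i → at Y (toℕ i ℕ.+ t)))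
  reverse₁  : ∀ {X Y} → Equiv (X , Y) ((λ i → X (opposite i)) , Y)
  reverse₂  : ∀ {X Y} → Equiv (X , Y) (X , (λ i → Y (opposite i)))
  decimate  : ∀ {X Y} (k : ℕ) → Coprime k n →
              Equiv (X , Y) ((λ i → at X (k ℕ.* toℕ i)) , (λ i → at Y (k ℕ.* toℕ i)))
  altNeg    : ∀ {X Y} →
              Equiv (X , Y) ((λ i → altSign (toℕ i) ℤ.* X i) , (λ i → altSign (toℕ i) ℤ.* Y i))
  refl′     : ∀ {P} → Equiv P P
  sym′      : ∀ {P Q} → Equiv P Q → Equiv Q P
  trans′    : ∀ {P Q R} → Equiv P Q → Equiv Q R → Equiv P R

seq2 : ℤ → ℤ → Seq 2
seq2 c d zero       = c
seq2 c d (suc zero) = d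

-- Let x0, x1 (y0, y1) be the sums of the entries of A (B) at even and at odd positions: the
-- entries of the compressions, all odd because p is odd. Summing PAF(A,s) + PAF(B,s) over all
-- shifts s, plainly and with weight (-1)^s, gives (x0 ± x1)² + (y0 ± y1)² = 4p, that is
-- x0² + x1² + y0² + y1² = 4p and x0 x1 + y0 y1 = 0. For odd numbers and a prime p these force
-- |y1| = |x0| or |y0| = |x0|, and orthogonality then leaves four sign patterns for (y0, y1),
-- each equivalent to the claimed normal form by shifts.

module Submission where

open import Defs

module PeriodicSums where

  open import Data.Integer using (ℤ; +_; -_; 0ℤ; 1ℤ; -1ℤ; _+_; _*_; _-_)
  open import Data.Integer.Properties
  open import Algebra.Properties.CommutativeSemigroup +-commutativeSemigroup using (interchange)
  open import Algebra.Properties.AbelianGroup +-0-abelianGroup using (∙-cancelˡ)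
  open import Data.Fin.Properties using (fromℕ<-cong)
  open import Data.Nat.DivMod using ([m+n]%n≡m%n; m*n/n≡m)
  open import Data.Integer.Tactic.RingSolver using (solve-∀)
  open import Data.Nat as ℕ using (ℕ; zero; suc; _≤_; _<_; z≤n; s≤s)
  import Data.Nat.Properties as ℕ
  import Algebra.Properties.CommutativeSemigroup ℕ.+-commutativeSemigroup as ℕ+
  open import Data.Product using (_,_)
  open import Data.Sum using (_⊎_; inj₁; inj₂)
  open import Function using (_∘_)
  open import Relation.Binary.PropositionalEquality
  open import Relation.Nullary using (yes; no)
  open ≡-Reasoning

  sumTo-cong : ∀ n {f g : ℕ → ℤ} → (∀ i → f i ≡ g i) → sumTo n f ≡ sumTo n g
  sumTo-cong zero    f≗g = refl
  sumTo-cong (suc n) f≗g = cong₂ _+_ (sumTo-cong n f≗g) (f≗g n)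

  sumTo-zero : ∀ n {f : ℕ → ℤ} → (∀ i → i < n → f i ≡ 0ℤ) → sumTo n f ≡ 0ℤ
  sumTo-zero zero    f≡0 = refl
  sumTo-zero (suc n) f≡0 =
    cong₂ _+_ (sumTo-zero n (λ i i<n → f≡0 i (ℕ.m<n⇒m<1+n i<n))) (f≡0 n (ℕ.n<1+n n))

  sumTo-one : ∀ n → sumTo n (λ _ → 1ℤ) ≡ + n
  sumTo-one zero    = refl
  sumTo-one (suc n) = trans (cong (_+ 1ℤ) (sumTo-one n)) (cong +_ (ℕ.+-comm n 1))

  sumTo-+ : ∀ n (f g : ℕ → ℤ) → sumTo n (λ i → f i + g i) ≡ sumTo n f + sumTo n g
  sumTo-+ zero    f g = refl
  sumTo-+ (suc n) f g =
    trans (cong (_+ (f n + g n)) (sumTo-+ n f g)) (interchange (sumTo n f) (sumTo n g) (f n) (g n))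

  sumTo-*ˡ : ∀ n c (f : ℕ → ℤ) → sumTo n (λ i → c * f i) ≡ c * sumTo n f
  sumTo-*ˡ zero    c f = sym (*-zeroʳ c)
  sumTo-*ˡ (suc n) c f = trans (cong (_+ c * f n) (sumTo-*ˡ n c f)) (sym (*-distribˡ-+ c _ (f n)))

  sumTo-*ʳ : ∀ n (f : ℕ → ℤ) c → sumTo n (λ i → f i * c) ≡ sumTo n f * c
  sumTo-*ʳ n f c = begin
    sumTo n (λ i → f i * c) ≡⟨ sumTo-cong n (λ i → *-comm (f i) c) ⟩
    sumTo n (λ i → c * f i) ≡⟨ sumTo-*ˡ n c f ⟩
    c * sumTo n f           ≡⟨ *-comm c _ ⟩
    sumTo n f * c           ∎

  sumTo-swap : ∀ m n (g : ℕ → ℕ → ℤ) →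
               sumTo m (λ i → sumTo n (g i)) ≡ sumTo n (λ j → sumTo m (λ i → g i j))
  sumTo-swap zero    n g = sym (sumTo-zero n (λ _ _ → refl))
  sumTo-swap (suc m) n g =
    trans (cong (_+ sumTo n (g m)) (sumTo-swap m n g)) (sym (sumTo-+ n _ (g m)))

  sumTo-suc : ∀ n (f : ℕ → ℤ) → sumTo (suc n) f ≡ f 0 + sumTo n (f ∘ suc)
  sumTo-suc zero    f = +-comm 0ℤ (f 0)
  sumTo-suc (suc n) f = trans (cong (_+ f (suc n)) (sumTo-suc n f)) (+-assoc (f 0) _ _)

  -- compress p 2 X zero and compress p 2 X (suc zero) are evens p (at X) and odds p (at X).
  evens odds : ℕ → (ℕ → ℤ) → ℤ
  evens p f = sumTo p (λ j → f (j ℕ.* 2))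
  odds  p f = sumTo p (λ j → f (suc (j ℕ.* 2)))

  sumTo-*2 : ∀ p (f : ℕ → ℤ) → sumTo (p ℕ.* 2) f ≡ evens p f + odds p f
  sumTo-*2 zero    f = refl
  sumTo-*2 (suc p) f =
    trans (cong (λ s → s + f (p ℕ.* 2) + f (suc (p ℕ.* 2))) (sumTo-*2 p f))
          (trans (+-assoc (evens p f + odds p f) _ _) (interchange (evens p f) (odds p f) _ _))

  Periodic : ℕ → (ℕ → ℤ) → Set
  Periodic n f = ∀ k → f (k ℕ.+ n) ≡ f k

  at-periodic : ∀ {n} (X : Seq n) → Periodic n (at X)
  at-periodic {zero}  X k = refl
  at-periodic {suc n} X k = cong X (fromℕ<-cong _ _ ([m+n]%n≡m%n k (suc n)) _ _)

  periodic-shift : ∀ {n f} → Periodic n f → ∀ t → Periodic n (λ k → f (k ℕ.+ t))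
  periodic-shift {n} {f} per t k =
    trans (cong f (ℕ+.xy∙z≈xz∙y k n t)) (per (k ℕ.+ t))

  periodic-* : ∀ {n f g} → Periodic n f → Periodic n g → Periodic n (λ k → f k * g k)
  periodic-* perf perg k = cong₂ _*_ (perf k) (perg k)

  sumTo-rotate : ∀ n {f} → Periodic n f → ∀ k → sumTo n (λ i → f (k ℕ.+ i)) ≡ sumTo n f
  sumTo-rotate n         per zero    = refl
  sumTo-rotate n {f} per (suc k) = begin
    sumTo n (λ i → f (suc k ℕ.+ i)) ≡⟨ sumTo-cong n (λ i → cong f (sym (ℕ.+-suc k i))) ⟩
    sumTo n (h ∘ suc)               ≡⟨ ∙-cancelˡ (h 0) _ _ rotated ⟩
    sumTo n h                       ≡⟨ sumTo-rotate n per k ⟩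
    sumTo n f                       ∎
    where
    h : ℕ → ℤ
    h i = f (k ℕ.+ i)
    rotated : h 0 + sumTo n (h ∘ suc) ≡ h 0 + sumTo n h
    rotated = begin
      h 0 + sumTo n (h ∘ suc) ≡⟨ sumTo-suc n h ⟨
      sumTo n h + h n         ≡⟨ cong (_+_ (sumTo n h)) (trans (per k) (cong f (sym (ℕ.+-identityʳ k)))) ⟩
      sumTo n h + h 0         ≡⟨ +-comm (sumTo n h) (h 0) ⟩
      h 0 + sumTo n h         ∎

  paf : ℕ → (ℕ → ℤ) → ℕ → ℤ
  paf n f s = sumTo n (λ k → f k * f (k ℕ.+ s))

  sumTo-paf : ∀ n {f} → Periodic n f → sumTo n (paf n f) ≡ sumTo n f * sumTo n f
  sumTo-paf n {f} per = begin
    sumTo n (λ s → sumTo n (λ k → f k * f (k ℕ.+ s))) ≡⟨ sumTo-swap n n _ ⟩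
    sumTo n (λ k → sumTo n (λ s → f k * f (k ℕ.+ s))) ≡⟨ sumTo-cong n (λ k → sumTo-*ˡ n (f k) _) ⟩
    sumTo n (λ k → f k * sumTo n (λ s → f (k ℕ.+ s)))
      ≡⟨ sumTo-cong n (λ k → cong (f k *_) (sumTo-rotate n per k)) ⟩
    sumTo n (λ k → f k * sumTo n f)                   ≡⟨ sumTo-*ʳ n f _ ⟩
    sumTo n f * sumTo n f                             ∎

  paf-complement : ∀ n {f} → Periodic n f → ∀ {s t} → s ℕ.+ t ≡ n → paf n f s ≡ paf n f t
  paf-complement n {f} per {s} {t} s+t≡n = begin
    sumTo n (λ k → f k * f (k ℕ.+ s))    ≡⟨ sumTo-cong n (λ k → *-comm (f k) _) ⟩
    sumTo n (λ k → f (k ℕ.+ s) * f k)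
      ≡⟨ sumTo-cong n (λ k → cong₂ _*_ (cong f (ℕ.+-comm k s)) (sym (wrap k))) ⟩
    sumTo n (λ k → g (s ℕ.+ k))          ≡⟨ sumTo-rotate n (periodic-* per (periodic-shift per t)) s ⟩
    sumTo n g                            ∎
    where
    g : ℕ → ℤ
    g k = f k * f (k ℕ.+ t)
    wrap : ∀ k → f (s ℕ.+ k ℕ.+ t) ≡ f k
    wrap k = trans (cong f (trans (ℕ+.xy∙z≈y∙xz s k t) (cong (k ℕ.+_) s+t≡n))) (per k)

  ±1-valued : (ℕ → ℤ) → Set
  ±1-valued f = ∀ i → f i ≡ 1ℤ ⊎ f i ≡ -1ℤ

  at-±1 : ∀ {n} {X : Seq (suc n)} → IsBinary X → ±1-valued (at X)
  at-±1 binary i = binary _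

  paf-±1-zero : ∀ n {f} → ±1-valued f → paf n f 0 ≡ + n
  paf-±1-zero n {f} ±1 = trans (sumTo-cong n square≡1) (sumTo-one n)
    where
    square≡1 : ∀ k → f k * f (k ℕ.+ 0) ≡ 1ℤ
    square≡1 k rewrite ℕ.+-identityʳ k with ±1 k
    ... | inj₁ f≡1  rewrite f≡1  = refl
    ... | inj₂ f≡-1 rewrite f≡-1 = refl

  altSign-suc : ∀ k → altSign (suc k) ≡ - altSign k
  altSign-suc zero          = refl
  altSign-suc (suc zero)    = refl
  altSign-suc (suc (suc k)) = altSign-suc k

  altSign-+ : ∀ k s → altSign (k ℕ.+ s) ≡ altSign k * altSign s
  altSign-+ zero          s = sym (*-identityˡ (altSign s))
  altSign-+ (suc zero)    s = trans (altSign-suc s) (sym (-1*i≡-i (altSign s)))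
  altSign-+ (suc (suc k)) s = altSign-+ k s

  altSign-square : ∀ k → altSign k * altSign k ≡ 1ℤ
  altSign-square zero          = refl
  altSign-square (suc zero)    = refl
  altSign-square (suc (suc k)) = altSign-square k

  altSign-even : ∀ j → altSign (j ℕ.* 2) ≡ 1ℤ
  altSign-even zero    = refl
  altSign-even (suc j) = altSign-even j

  altSign-odd : ∀ j → altSign (suc (j ℕ.* 2)) ≡ -1ℤ
  altSign-odd zero    = refl
  altSign-odd (suc j) = altSign-odd j

  altSign-periodic : ∀ p → Periodic (p ℕ.* 2) altSign
  altSign-periodic p k =
    trans (altSign-+ k (p ℕ.* 2)) (trans (cong (altSign k *_) (altSign-even p)) (*-identityʳ _))

  alternate : (ℕ → ℤ) → ℕ → ℤ
  alternate f k = altSign k * f k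

  sumTo-alternate-*2 : ∀ p (f : ℕ → ℤ) → sumTo (p ℕ.* 2) (alternate f) ≡ evens p f - odds p f
  sumTo-alternate-*2 p f = trans (sumTo-*2 p (alternate f)) (cong₂ _+_ evens≡ odds≡)
    where
    evens≡ : evens p (alternate f) ≡ evens p f
    evens≡ = sumTo-cong p (λ j → trans (cong (_* f (j ℕ.* 2)) (altSign-even j)) (*-identityˡ _))
    odds≡ : odds p (alternate f) ≡ - odds p f
    odds≡ = trans (sumTo-cong p (λ j → cong (_* f (suc (j ℕ.* 2))) (altSign-odd j)))
                  (trans (sumTo-*ˡ p -1ℤ _) (-1*i≡-i _))

  paf-alternate : ∀ n f s → paf n (alternate f) s ≡ altSign s * paf n f s
  paf-alternate n f s = trans (sumTo-cong n twisted) (sumTo-*ˡ n (altSign s) _)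
    where
    regroup : ∀ a b x y → a * x * (a * b * y) ≡ a * a * (b * (x * y))
    regroup = solve-∀
    twisted : ∀ k → alternate f k * alternate f (k ℕ.+ s) ≡ altSign s * (f k * f (k ℕ.+ s))
    twisted k = begin
      altSign k * f k * (altSign (k ℕ.+ s) * f (k ℕ.+ s))
        ≡⟨ cong (λ a → altSign k * f k * (a * f (k ℕ.+ s))) (altSign-+ k s) ⟩
      altSign k * f k * (altSign k * altSign s * f (k ℕ.+ s))
        ≡⟨ regroup (altSign k) (altSign s) (f k) (f (k ℕ.+ s)) ⟩
      altSign k * altSign k * (altSign s * (f k * f (k ℕ.+ s)))
        ≡⟨ trans (cong (_* (altSign s * (f k * f (k ℕ.+ s)))) (altSign-square k)) (*-identityˡ _) ⟩
      altSign s * (f k * f (k ℕ.+ s))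
        ∎

  Complementary : ℕ → (ℕ → ℤ) → (ℕ → ℤ) → Set
  Complementary n f g = ∀ s → 1 ≤ s → s < n → paf n f s + paf n g s ≡ 0ℤ

  complementary-alternate : ∀ {n f g} → Complementary n f g →
                            Complementary n (alternate f) (alternate g)
  complementary-alternate {n} {f} {g} compl s 1≤s s<n = begin
    paf n (alternate f) s + paf n (alternate g) s ≡⟨ cong₂ _+_ (paf-alternate n f s) (paf-alternate n g s) ⟩
    altSign s * paf n f s + altSign s * paf n g s ≡⟨ *-distribˡ-+ (altSign s) _ _ ⟨
    altSign s * (paf n f s + paf n g s)           ≡⟨ cong (altSign s *_) (compl s 1≤s s<n) ⟩
    altSign s * 0ℤ                                ≡⟨ *-zeroʳ (altSign s) ⟩
    0ℤ                                            ∎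

  complementary-sum-squares : ∀ n {f g} → Periodic n f → Periodic n g → Complementary n f g →
    sumTo n f * sumTo n f + sumTo n g * sumTo n g ≡ paf n f 0 + paf n g 0
  complementary-sum-squares zero          _    _    _     = refl
  complementary-sum-squares n@(suc m) {f} {g} perf perg compl = begin
    sumTo n f * sumTo n f + sumTo n g * sumTo n g  ≡⟨ cong₂ _+_ (sumTo-paf n perf) (sumTo-paf n perg) ⟨
    sumTo n (paf n f) + sumTo n (paf n g)          ≡⟨ sumTo-+ n (paf n f) (paf n g) ⟨
    sumTo n pafs                                   ≡⟨ sumTo-suc m pafs ⟩
    pafs 0 + sumTo m (pafs ∘ suc)                  ≡⟨ cong (_+_ (pafs 0)) (sumTo-zero m vanishing) ⟩
    pafs 0 + 0ℤ                                    ≡⟨ +-identityʳ (pafs 0) ⟩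
    pafs 0                                         ∎
    where
    pafs : ℕ → ℤ
    pafs s = paf n f s + paf n g s
    vanishing : ∀ s → s < m → pafs (suc s) ≡ 0ℤ
    vanishing s s<m = compl (suc s) (s≤s z≤n) (s≤s s<m)

  complementary-alternate-sum-squares : ∀ p {f g} → Periodic (p ℕ.* 2) f → Periodic (p ℕ.* 2) g →
    Complementary (p ℕ.* 2) f g → let n = p ℕ.* 2 in
    sumTo n (alternate f) * sumTo n (alternate f) + sumTo n (alternate g) * sumTo n (alternate g)
    ≡ paf n f 0 + paf n g 0
  complementary-alternate-sum-squares p {f} {g} perf perg compl =
    trans (complementary-sum-squares (p ℕ.* 2) (alternate-periodic perf) (alternate-periodic perg)
                                     (complementary-alternate compl))
          (cong₂ _+_ (paf-alternate-zero f) (paf-alternate-zero g))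
    where
    alternate-periodic : ∀ {h} → Periodic (p ℕ.* 2) h → Periodic (p ℕ.* 2) (alternate h)
    alternate-periodic = periodic-* (altSign-periodic p)
    paf-alternate-zero : ∀ h → paf (p ℕ.* 2) (alternate h) 0 ≡ paf (p ℕ.* 2) h 0
    paf-alternate-zero h = trans (paf-alternate (p ℕ.* 2) h 0) (*-identityˡ _)

  complementary-from-half : ∀ p {f g} → Periodic (p ℕ.* 2) f → Periodic (p ℕ.* 2) g →
    (∀ s → 1 ≤ s → s ≤ p → paf (p ℕ.* 2) f s + paf (p ℕ.* 2) g s ≡ 0ℤ) →
    Complementary (p ℕ.* 2) f g
  complementary-from-half p perf perg half s 1≤s s<2p with s ℕ.≤? p
  ... | yes s≤p = half s 1≤s s≤p
  ... | no  s≰p = trans (cong₂ _+_ (paf-complement _ perf s+t≡2p) (paf-complement _ perg s+t≡2p))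
                        (half t (ℕ.m<n⇒0<n∸m s<2p) t≤p)
    where
    t = p ℕ.* 2 ℕ.∸ s
    s+t≡2p : s ℕ.+ t ≡ p ℕ.* 2
    s+t≡2p = ℕ.m+[n∸m]≡n (ℕ.<⇒≤ s<2p)
    2p≤s+p : p ℕ.* 2 ≤ s ℕ.+ p
    2p≤s+p = subst (_≤ s ℕ.+ p) (sym (trans (ℕ.*-suc p 1) (cong (p ℕ.+_) (ℕ.*-identityʳ p))))
                   (ℕ.+-monoˡ-≤ p (ℕ.<⇒≤ (ℕ.≰⇒> s≰p)))
    t≤p : t ≤ p
    t≤p = ℕ.m≤n+o⇒m∸n≤o (p ℕ.* 2) s 2p≤s+p

  golay-complementary : ∀ p {A B : Seq (p ℕ.* 2)} → IsPeriodicGolayPair (p ℕ.* 2) A B →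
                        Complementary (p ℕ.* 2) (at A) (at B)
  golay-complementary p {A} {B} (_ , _ , golay) =
    complementary-from-half p (at-periodic A) (at-periodic B)
      (λ s 1≤s s≤p → golay s 1≤s (subst (s ≤_) (sym (m*n/n≡m p 2)) s≤p))

module OddSquares where

  open import Data.Nat
  open import Data.Nat.Properties
  import Algebra.Properties.CommutativeSemigroup +-commutativeSemigroup as ℕ+
  open import Data.Nat.DivMod using (_%_; _/_; m%n<n; m≡m%n+[m/n]*n)
  open import Data.Nat.Divisibility using (_∣_; divides; m%n≡0⇒n∣m)
  open import Data.Nat.Primality using (Prime; euclidsLemma; prime⇒nonZero)
  open import Data.Nat.Tactic.RingSolver using (solve-∀)
  open import Data.Product using (∃-syntax; _,_)
  open import Data.Sum using (_⊎_; inj₁; inj₂; [_,_]′)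
  open import Function using (_∘_)
  open import Relation.Binary.Definitions using (tri<; tri≈; tri>)
  open import Relation.Binary.PropositionalEquality
  open import Relation.Nullary using (¬_; contradiction)
  open ≡-Reasoning

  Odd : ℕ → Set
  Odd n = ∃[ a ] n ≡ suc (a * 2)

  ¬2∣⇒odd : ∀ {n} → ¬ 2 ∣ n → Odd n
  ¬2∣⇒odd {n} 2∤n with n % 2 | m%n<n n 2 | m≡m%n+[m/n]*n n 2 | m%n≡0⇒n∣m n 2
  ... | 0 | _ | _ | 2∣n = contradiction (2∣n refl) 2∤n
  ... | 1 | _ | n≡1+[n/2]*2 | _ = n / 2 , n≡1+[n/2]*2
  ... | suc (suc _) | s≤s (s≤s ()) | _ | _

  sum-odd-squares : ∀ {x y} → Odd x → Odd y → ∃[ r ] x * x + y * y ≡ 2 * suc r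
  sum-odd-squares (a , refl) (b , refl) = a * 2 + a * a * 2 + b * 2 + b * b * 2 , expand a b
    where
    expand : ∀ a b → suc (a * 2) * suc (a * 2) + suc (b * 2) * suc (b * 2)
                   ≡ 2 * suc (a * 2 + a * a * 2 + b * 2 + b * b * 2)
    expand = solve-∀

  m*m≡n*n⇒m≡n : ∀ m n → m * m ≡ n * n → m ≡ n
  m*m≡n*n⇒m≡n m n eq with <-cmp m n
  ... | tri< m<n _ _ = contradiction eq (<⇒≢ (*-mono-< m<n m<n))
  ... | tri≈ _ m≡n _ = m≡n
  ... | tri> _ _ n<m = contradiction eq (>⇒≢ (*-mono-< n<m n<m))

  m∣n<2m⇒n≡m : ∀ {m n} → m ∣ n → 0 < n → n < 2 * m → n ≡ m
  m∣n<2m⇒n≡m           (divides 0 refl)             ()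
  m∣n<2m⇒n≡m {m}       (divides 1 refl)             _ _    = +-identityʳ m
  m∣n<2m⇒n≡m {m}       (divides (suc (suc q)) refl) _ n<2m =
    contradiction n<2m (≤⇒≯ (*-monoˡ-≤ m (m≤m+n 2 q)))

  sum-squares-product : ∀ x0 x1 y0 y1 → x0 * x1 ≡ y0 * y1 →
    (x0 * x0 + y0 * y0) * (x0 * x0 + y1 * y1) ≡ x0 * x0 * (x0 * x0 + x1 * x1 + y0 * y0 + y1 * y1)
  sum-squares-product x0 x1 y0 y1 x0x1≡y0y1 = +-cancelʳ-≡ (x0 * x1 * (x0 * x1)) _ _ (begin
    (x0 * x0 + y0 * y0) * (x0 * x0 + y1 * y1) + x0 * x1 * (x0 * x1)
      ≡⟨ expand x0 x1 y0 y1 ⟩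
    x0 * x0 * total + y0 * y1 * (y0 * y1)
      ≡⟨ cong (λ m → x0 * x0 * total + m * m) x0x1≡y0y1 ⟨
    x0 * x0 * total + x0 * x1 * (x0 * x1)
      ∎)
    where
    total = x0 * x0 + x1 * x1 + y0 * y0 + y1 * y1
    expand : ∀ x0 x1 y0 y1 →
      (x0 * x0 + y0 * y0) * (x0 * x0 + y1 * y1) + x0 * x1 * (x0 * x1)
      ≡ x0 * x0 * (x0 * x0 + x1 * x1 + y0 * y0 + y1 * y1) + y0 * y1 * (y0 * y1)
    expand = solve-∀

  x0²+y0²≡2p⇒y1≡x0 : ∀ {p} x0 x1 y0 y1 .{{_ : NonZero p}} →
    x0 * x0 + x1 * x1 + y0 * y0 + y1 * y1 ≡ 4 * p → x0 * x1 ≡ y0 * y1 →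
    x0 * x0 + y0 * y0 ≡ 2 * p → y1 ≡ x0
  x0²+y0²≡2p⇒y1≡x0 {p} x0 x1 y0 y1 squares products half =
    m*m≡n*n⇒m≡n y1 x0 (+-cancelˡ-≡ (x0 * x0) _ _ (*-cancelˡ-≡ _ _ (2 * p) {{m*n≢0 2 p}} (begin
      2 * p * (x0 * x0 + y1 * y1)                        ≡⟨ cong (_* (x0 * x0 + y1 * y1)) half ⟨
      (x0 * x0 + y0 * y0) * (x0 * x0 + y1 * y1)          ≡⟨ sum-squares-product x0 x1 y0 y1 products ⟩
      x0 * x0 * (x0 * x0 + x1 * x1 + y0 * y0 + y1 * y1)  ≡⟨ cong (x0 * x0 *_) squares ⟩
      x0 * x0 * (4 * p)                                  ≡⟨ regroup (x0 * x0) p ⟩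
      2 * p * (x0 * x0 + x0 * x0)                        ∎)))
    where
    regroup : ∀ m p → m * (4 * p) ≡ 2 * p * (m + m)
    regroup = solve-∀

  p∣half⇒≡2p : ∀ {p a b} r t → a ≡ 2 * suc r → b ≡ 2 * suc t → a + b ≡ 4 * p → p ∣ suc r → a ≡ 2 * p
  p∣half⇒≡2p {p} r t refl refl a+b≡4p p∣R = cong (2 *_) (m∣n<2m⇒n≡m p∣R z<s R<2p)
    where
    R+T≡2p : suc r + suc t ≡ 2 * p
    R+T≡2p = *-cancelˡ-≡ _ _ 2 (trans (*-distribˡ-+ 2 (suc r) (suc t)) (trans a+b≡4p (*-assoc 2 2 p)))
    R<2p : suc r < 2 * p
    R<2p = subst (suc r <_) R+T≡2p (m<m+n (suc r) z<s)

  -- (x0² + y0²)(x0² + y1²) = 4p x0², so p divides the half R of x0² + y0² or the half S of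
  -- x0² + y1²; as R + T = 2p for the positive half T of x1² + y1² (likewise for S), it equals p.
  odd-four-squares : ∀ {p x0 x1 y0 y1} → Prime p → Odd x0 → Odd x1 → Odd y0 → Odd y1 →
    x0 * x0 + x1 * x1 + y0 * y0 + y1 * y1 ≡ 4 * p → x0 * x1 ≡ y0 * y1 → y1 ≡ x0 ⊎ y0 ≡ x0
  odd-four-squares {p} {x0} {x1} {y0} {y1} p-prime ox0 ox1 oy0 oy1 squares products
    with sum-odd-squares ox0 oy0 | sum-odd-squares ox1 oy1 | sum-odd-squares ox0 oy1 | sum-odd-squares ox1 oy0
  ... | r , x0y0≡2R | t , x1y1≡2T | s , x0y1≡2S | u , x1y0≡2U =
    [ inj₁ ∘ x0²+y0²≡2p⇒y1≡x0 x0 x1 y0 y1 squares products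
           ∘ p∣half⇒≡2p r t x0y0≡2R x1y1≡2T (trans (shuffle (x0 * x0) (x1 * x1) (y0 * y0) (y1 * y1)) squares)
    , inj₂ ∘ x0²+y0²≡2p⇒y1≡x0 x0 x1 y1 y0 squares′ (trans products (*-comm y0 y1))
           ∘ p∣half⇒≡2p s u x0y1≡2S x1y0≡2U (trans (shuffle (x0 * x0) (x1 * x1) (y1 * y1) (y0 * y0)) squares′)
    ]′ (euclidsLemma (suc r) (suc s) p-prime (divides (x0 * x0) R*S≡X*p))
    where
    instance
      p≢0 : NonZero p
      p≢0 = prime⇒nonZero p-prime
    shuffle : ∀ a b c d → a + c + (b + d) ≡ a + b + c + d
    shuffle = solve-∀
    squares′ : x0 * x0 + x1 * x1 + y1 * y1 + y0 * y0 ≡ 4 * p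
    squares′ = trans (ℕ+.xy∙z≈xz∙y _ (y1 * y1) (y0 * y0)) squares
    R*S≡X*p : suc r * suc s ≡ x0 * x0 * p
    R*S≡X*p = *-cancelˡ-≡ _ _ 4 (begin
      4 * (suc r * suc s)                                ≡⟨ regroup₁ (suc r) (suc s) ⟩
      2 * suc r * (2 * suc s)                            ≡⟨ cong₂ _*_ x0y0≡2R x0y1≡2S ⟨
      (x0 * x0 + y0 * y0) * (x0 * x0 + y1 * y1)          ≡⟨ sum-squares-product x0 x1 y0 y1 products ⟩
      x0 * x0 * (x0 * x0 + x1 * x1 + y0 * y0 + y1 * y1)  ≡⟨ cong (x0 * x0 *_) squares ⟩
      x0 * x0 * (4 * p)                                  ≡⟨ regroup₂ (x0 * x0) p ⟩
      4 * (x0 * x0 * p)                                  ∎)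
      where
      regroup₁ : ∀ a b → 4 * (a * b) ≡ 2 * a * (2 * b)
      regroup₁ = solve-∀
      regroup₂ : ∀ m p → m * (4 * p) ≡ 4 * (m * p)
      regroup₂ = solve-∀

module Compression where

  open import Data.Empty using (⊥-elim)
  open import Data.Fin using (zero; suc)
  open import Data.Integer
    using (ℤ; +_; +[1+_]; -[1+_]; -_; 0ℤ; 1ℤ; -1ℤ; _+_; _*_; _-_; ∣_∣; _/_; _/ℕ_; NonZero)
  open import Data.Integer.DivMod using (div-pos-is-/ℕ)
  open import Data.Integer.Properties
  open import Algebra.Properties.AbelianGroup +-0-abelianGroup using (inverseˡ-unique; inverseʳ-unique)
  open import Data.Integer.Tactic.RingSolver using (solve-∀)
  import Data.Nat as ℕ
  import Data.Nat.DivMod as ℕ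
  open import Data.Nat.Divisibility using (_∣_)
  open import Data.Nat.Primality using (Prime; prime⇒nonZero)
  import Data.Nat.Tactic.RingSolver as ℕ
  open import Data.Product using (∃-syntax; _,_)
  open import Data.Sum using (_⊎_; inj₁; inj₂; [_,_]′)
  open import Function using (_∘_)
  open import Relation.Binary.PropositionalEquality
  open import Relation.Nullary using (¬_)
  open ≡-Reasoning
  open PeriodicSums
  open OddSquares using (Odd; ¬2∣⇒odd; odd-four-squares)

  ±1-sum-parity : ∀ n {f} → ±1-valued f → ∃[ t ] sumTo n f ≡ + n + t * + 2
  ±1-sum-parity ℕ.zero      ±1 = 0ℤ , refl
  ±1-sum-parity (ℕ.suc n) {f} ±1 with ±1-sum-parity n ±1 | ±1 n
  ... | t , eq | inj₁ fn≡1  = t , trans (cong₂ _+_ eq fn≡1) (plus-one (+ n) t)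
    where plus-one : ∀ m t → m + t * + 2 + 1ℤ ≡ 1ℤ + m + t * + 2
          plus-one = solve-∀
  ... | t , eq | inj₂ fn≡-1 = t - 1ℤ , trans (cong₂ _+_ eq fn≡-1) (minus-one (+ n) t)
    where minus-one : ∀ m t → m + t * + 2 + -1ℤ ≡ 1ℤ + m + (t - 1ℤ) * + 2
          minus-one = solve-∀

  ∣1+t*2∣-odd : ∀ t → Odd ∣ 1ℤ + t * + 2 ∣
  ∣1+t*2∣-odd (+ n)    = n , cong (λ i → ∣ 1ℤ + i ∣) (sym (pos-* n 2))
  ∣1+t*2∣-odd -[1+ n ] = n , refl

  ±1-sum-odd : ∀ {n f} → Odd n → ±1-valued f → Odd ∣ sumTo n f ∣
  ±1-sum-odd {n} {f} (m , refl) ±1 with ±1-sum-parity n ±1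
  ... | t , eq = subst (λ i → Odd ∣ i ∣) (sym sum≡) (∣1+t*2∣-odd (+ m + t))
    where
    regroup : ∀ m t → 1ℤ + m * + 2 + t * + 2 ≡ 1ℤ + (m + t) * + 2
    regroup = solve-∀
    sum≡ : sumTo n f ≡ 1ℤ + (+ m + t) * + 2
    sum≡ = trans eq (trans (cong (λ i → 1ℤ + i + t * + 2) (pos-* m 2)) (regroup (+ m) t))

  i*i≡∣i∣*∣i∣ : ∀ i → i * i ≡ + (∣ i ∣ ℕ.* ∣ i ∣)
  i*i≡∣i∣*∣i∣ (+ ℕ.zero)  = refl
  i*i≡∣i∣*∣i∣ +[1+ n ]    = refl
  i*i≡∣i∣*∣i∣ -[1+ n ]    = refl

  +-sum-of-abs-squares : ∀ a b c d →
    + (∣ a ∣ ℕ.* ∣ a ∣ ℕ.+ ∣ b ∣ ℕ.* ∣ b ∣ ℕ.+ ∣ c ∣ ℕ.* ∣ c ∣ ℕ.+ ∣ d ∣ ℕ.* ∣ d ∣)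
    ≡ a * a + b * b + c * c + d * d
  +-sum-of-abs-squares a b c d = begin
    + (A ℕ.+ B ℕ.+ C ℕ.+ D)       ≡⟨ pos-+ (A ℕ.+ B ℕ.+ C) D ⟩
    + (A ℕ.+ B ℕ.+ C) + + D       ≡⟨ cong (_+ (+ D)) (trans (pos-+ (A ℕ.+ B) C) (cong (_+ (+ C)) (pos-+ A B))) ⟩
    + A + + B + + C + + D         ≡⟨ cong₂ _+_ (cong₂ _+_ (cong₂ _+_ (sq a) (sq b)) (sq c)) (sq d) ⟩
    a * a + b * b + c * c + d * d ∎
    where
    A = ∣ a ∣ ℕ.* ∣ a ∣
    B = ∣ b ∣ ℕ.* ∣ b ∣
    C = ∣ c ∣ ℕ.* ∣ c ∣
    D = ∣ d ∣ ℕ.* ∣ d ∣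
    sq : ∀ i → + (∣ i ∣ ℕ.* ∣ i ∣) ≡ i * i
    sq i = sym (i*i≡∣i∣*∣i∣ i)

  ∣i∣≡∣j∣⇒i≡j⊎i≡-j : ∀ i j → ∣ i ∣ ≡ ∣ j ∣ → i ≡ j ⊎ i ≡ - j
  ∣i∣≡∣j∣⇒i≡j⊎i≡-j (+ m)    (+ n)    eq   = inj₁ (cong +_ eq)
  ∣i∣≡∣j∣⇒i≡j⊎i≡-j (+ m)    -[1+ n ] eq   = inj₂ (cong +_ eq)
  ∣i∣≡∣j∣⇒i≡j⊎i≡-j -[1+ m ] (+ n)    refl = inj₂ refl
  ∣i∣≡∣j∣⇒i≡j⊎i≡-j -[1+ m ] -[1+ n ] refl = inj₁ refl

  odd-cancel : ∀ x {u v} → Odd ∣ x ∣ → x * u + x * v ≡ 0ℤ → v ≡ - u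
  odd-cancel x {u} {v} (a , ∣x∣≡1+2a) xu+xv≡0 =
    inverseʳ-unique u v (*-cancelˡ-≡ x (u + v) 0ℤ {{x≢0}} (begin
      x * (u + v)   ≡⟨ *-distribˡ-+ x u v ⟩
      x * u + x * v ≡⟨ xu+xv≡0 ⟩
      0ℤ            ≡⟨ *-zeroʳ x ⟨
      x * 0ℤ        ∎))
    where
    x≢0 : NonZero x
    x≢0 = subst ℕ.NonZero (sym ∣x∣≡1+2a) _

  data Partner (x0 x1 : ℤ) : ℤ → ℤ → Set where
    flip₂      : Partner x0 x1 x0 (- x1)
    flip₁      : Partner x0 x1 (- x0) x1
    swap-flip₁ : Partner x0 x1 (- x1) x0
    swap-flip₂ : Partner x0 x1 x1 (- x0)

  module _ {x0 x1 y0 y1 : ℤ} (odd : Odd ∣ x0 ∣) (orthogonal : x0 * x1 + y0 * y1 ≡ 0ℤ) where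

    partner-via-y0 : y0 ≡ x0 ⊎ y0 ≡ - x0 → Partner x0 x1 y0 y1
    partner-via-y0 (inj₁ refl) = subst (Partner x0 x1 x0) (sym (odd-cancel x0 odd orthogonal)) flip₂
    partner-via-y0 (inj₂ refl) = subst (Partner x0 x1 (- x0)) (sym y1≡x1) flip₁
      where
      regroup : ∀ a b c → a * b + a * - c ≡ a * b + - a * c
      regroup = solve-∀
      y1≡x1 : y1 ≡ x1
      y1≡x1 = neg-injective (odd-cancel x0 odd (trans (regroup x0 x1 y1) orthogonal))

    partner-via-y1 : y1 ≡ x0 ⊎ y1 ≡ - x0 → Partner x0 x1 y0 y1
    partner-via-y1 (inj₁ refl) = subst (λ y → Partner x0 x1 y x0) (sym y0≡-x1) swap-flip₁
      where
      regroup : ∀ a b c → a * b + a * c ≡ a * b + c * a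
      regroup = solve-∀
      y0≡-x1 : y0 ≡ - x1
      y0≡-x1 = odd-cancel x0 odd (trans (regroup x0 x1 y0) orthogonal)
    partner-via-y1 (inj₂ refl) = subst (λ y → Partner x0 x1 y (- x0)) (sym y0≡x1) swap-flip₂
      where
      regroup : ∀ a b c → a * b + a * - c ≡ a * b + c * - a
      regroup = solve-∀
      y0≡x1 : y0 ≡ x1
      y0≡x1 = neg-injective (odd-cancel x0 odd (trans (regroup x0 x1 y0) orthogonal))

  partner : ∀ {p x0 x1 y0 y1} → Prime p → Odd ∣ x0 ∣ → Odd ∣ x1 ∣ → Odd ∣ y0 ∣ → Odd ∣ y1 ∣ →
    (x0 + x1) * (x0 + x1) + (y0 + y1) * (y0 + y1) ≡ + (4 ℕ.* p) →
    (x0 - x1) * (x0 - x1) + (y0 - y1) * (y0 - y1) ≡ + (4 ℕ.* p) →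
    Partner x0 x1 y0 y1
  partner {p} {x0} {x1} {y0} {y1} p-prime ox0 ox1 oy0 oy1 sum² diff² =
    [ partner-via-y1 ox0 orthogonal ∘ ∣i∣≡∣j∣⇒i≡j⊎i≡-j y1 x0
    , partner-via-y0 ox0 orthogonal ∘ ∣i∣≡∣j∣⇒i≡j⊎i≡-j y0 x0
    ]′ (odd-four-squares p-prime ox0 ox1 oy0 oy1 abs-squares abs-products)
    where
    K : ℤ
    K = + (4 ℕ.* p)
    sum+diff : ∀ a b c d → + 2 * (a * a + b * b + c * c + d * d)
             ≡ (a + b) * (a + b) + (c + d) * (c + d) + ((a - b) * (a - b) + (c - d) * (c - d))
    sum+diff = solve-∀
    sum-diff : ∀ a b c d → + 4 * (a * b + c * d)
             ≡ (a + b) * (a + b) + (c + d) * (c + d) - ((a - b) * (a - b) + (c - d) * (c - d))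
    sum-diff = solve-∀
    double : ∀ k → k + k ≡ + 2 * k
    double = solve-∀
    squares : x0 * x0 + x1 * x1 + y0 * y0 + y1 * y1 ≡ K
    squares = *-cancelˡ-≡ (+ 2) _ _ (trans (sum+diff x0 x1 y0 y1) (trans (cong₂ _+_ sum² diff²) (double K)))
    orthogonal : x0 * x1 + y0 * y1 ≡ 0ℤ
    orthogonal = *-cancelˡ-≡ (+ 4) _ _ (trans (sum-diff x0 x1 y0 y1)
      (trans (cong₂ _-_ sum² diff²) (trans (+-inverseʳ K) (sym (*-zeroʳ (+ 4))))))
    abs-squares :
      ∣ x0 ∣ ℕ.* ∣ x0 ∣ ℕ.+ ∣ x1 ∣ ℕ.* ∣ x1 ∣ ℕ.+ ∣ y0 ∣ ℕ.* ∣ y0 ∣ ℕ.+ ∣ y1 ∣ ℕ.* ∣ y1 ∣ ≡ 4 ℕ.* p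
    abs-squares = +-injective (trans (+-sum-of-abs-squares x0 x1 y0 y1) squares)
    abs-products : ∣ x0 ∣ ℕ.* ∣ x1 ∣ ≡ ∣ y0 ∣ ℕ.* ∣ y1 ∣
    abs-products = begin
      ∣ x0 ∣ ℕ.* ∣ x1 ∣ ≡⟨ abs-* x0 x1 ⟨
      ∣ x0 * x1 ∣       ≡⟨ cong ∣_∣ (inverseˡ-unique (x0 * x1) (y0 * y1) orthogonal) ⟩
      ∣ - (y0 * y1) ∣   ≡⟨ ∣-i∣≡∣i∣ (y0 * y1) ⟩
      ∣ y0 * y1 ∣       ≡⟨ abs-* y0 y1 ⟩
      ∣ y0 ∣ ℕ.* ∣ y1 ∣ ∎

  i*2/2≡i : ∀ i → i * + 2 / + 2 ≡ i
  i*2/2≡i i = trans (div-pos-is-/ℕ (i * + 2) 2) (halve-ℕ i)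
    where
    halve-ℕ : ∀ i → i * + 2 /ℕ 2 ≡ i
    halve-ℕ (+ n)    = trans (cong (_/ℕ 2) (sym (pos-* n 2))) (cong +_ (ℕ.m*n/n≡m n 2))
    halve-ℕ -[1+ n ] with ℕ.suc n ℕ.* 2 ℕ.% 2 | ℕ.m*n%n≡0 (ℕ.suc n) 2
    ... | .0 | refl = cong (λ m → - (+ m)) (ℕ.m*n/n≡m (ℕ.suc n) 2)

  halve : ∀ {i j} → i ≡ j * + 2 → i / + 2 ≡ j
  halve {j = j} refl = i*2/2≡i j

  seq2-η : (X : Seq 2) → ∀ i → X i ≡ seq2 (X zero) (X (suc zero)) i
  seq2-η X zero       = refl
  seq2-η X (suc zero) = refl

  normalForm : ℤ → ℤ → Pair 2
  normalForm a b = seq2 ((a + b) / + 2) ((a - b) / + 2) , seq2 ((a + b) / + 2) ((b - a) / + 2)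

  flip₂-normalForm : ∀ u w {a b} → a ≡ u + w → b ≡ u - w →
                     Equiv (seq2 u w , seq2 u (- w)) (normalForm a b)
  flip₂-normalForm u w refl refl =
    pointwise (λ { zero → sym (halve (a+b u w)) ; (suc zero) → sym (halve (a-b u w)) })
              (λ { zero → sym (halve (a+b u w)) ; (suc zero) → sym (halve (b-a u w)) })
    where
    a+b : ∀ u w → u + w + (u - w) ≡ u * + 2
    a+b = solve-∀
    a-b : ∀ u w → u + w - (u - w) ≡ w * + 2
    a-b = solve-∀
    b-a : ∀ u w → u - w - (u + w) ≡ - w * + 2
    b-a = solve-∀

  rotate₁ : ∀ {c d} {Y : Seq 2} → Equiv (seq2 c d , Y) (seq2 d c , Y)
  rotate₁ = trans′ (shift₁ 1) (pointwise (λ { zero → refl ; (suc zero) → refl }) (λ _ → refl))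

  rotate₂ : ∀ {X : Seq 2} {c d} → Equiv (X , seq2 c d) (X , seq2 d c)
  rotate₂ = trans′ (shift₂ 1) (pointwise (λ _ → refl) (λ { zero → refl ; (suc zero) → refl }))

  partner-normalForm : ∀ {x0 x1 y0 y1} → Partner x0 x1 y0 y1 →
                       Equiv (seq2 x0 x1 , seq2 y0 y1) (normalForm (x0 + x1) (y0 + y1))
  partner-normalForm {x0} {x1} flip₂      = flip₂-normalForm x0 x1 refl refl
  partner-normalForm {x0} {x1} flip₁      =
    trans′ rotate₁ (trans′ rotate₂ (flip₂-normalForm x1 x0 (+-comm x0 x1) (+-comm (- x0) x1)))
  partner-normalForm {x0} {x1} swap-flip₁ = trans′ rotate₂ (flip₂-normalForm x0 x1 refl (+-comm (- x1) x0))
  partner-normalForm {x0} {x1} swap-flip₂ = trans′ rotate₁ (flip₂-normalForm x1 x0 (+-comm x0 x1) refl)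

  golay-compression-partner : ∀ {p} → Prime p → ¬ 2 ∣ p →
    (A B : Seq (p ℕ.* 2)) → IsPeriodicGolayPair (p ℕ.* 2) A B →
    Partner (compress p 2 A zero) (compress p 2 A (suc zero)) (compress p 2 B zero) (compress p 2 B (suc zero))
  golay-compression-partner {ℕ.zero} p-prime = ⊥-elim (ℕ.NonZero.nonZero (prime⇒nonZero p-prime))
  golay-compression-partner {p@(ℕ.suc _)} p-prime 2∤p A B golay@(binaryA , binaryB , _) =
    partner p-prime (odd-evens binaryA) (odd-odds binaryA) (odd-evens binaryB) (odd-odds binaryB) sum² diff²
    where
    n = p ℕ.* 2
    f = at A
    g = at B
    x0 = compress p 2 A zero
    x1 = compress p 2 A (suc zero)
    y0 = compress p 2 B zero
    y1 = compress p 2 B (suc zero)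
    compl : Complementary n f g
    compl = golay-complementary p golay
    odd-evens : ∀ {X : Seq n} → IsBinary X → Odd ∣ evens p (at X) ∣
    odd-evens binary = ±1-sum-odd (¬2∣⇒odd 2∤p) (λ j → at-±1 binary (j ℕ.* 2))
    odd-odds : ∀ {X : Seq n} → IsBinary X → Odd ∣ odds p (at X) ∣
    odd-odds binary = ±1-sum-odd (¬2∣⇒odd 2∤p) (λ j → at-±1 binary (ℕ.suc (j ℕ.* 2)))
    square : ∀ {a b} → a ≡ b → a * a ≡ b * b
    square a≡b = cong₂ _*_ a≡b a≡b
    n+n≡4p : ∀ p → p ℕ.* 2 ℕ.+ p ℕ.* 2 ≡ 4 ℕ.* p
    n+n≡4p = ℕ.solve-∀
    pafs-at-zero : paf n f 0 + paf n g 0 ≡ + (4 ℕ.* p)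
    pafs-at-zero = begin
      paf n f 0 + paf n g 0 ≡⟨ cong₂ _+_ (paf-±1-zero n (at-±1 binaryA)) (paf-±1-zero n (at-±1 binaryB)) ⟩
      + n + + n             ≡⟨ pos-+ n n ⟨
      + (n ℕ.+ n)           ≡⟨ cong +_ (n+n≡4p p) ⟩
      + (4 ℕ.* p)           ∎
    sum² : (x0 + x1) * (x0 + x1) + (y0 + y1) * (y0 + y1) ≡ + (4 ℕ.* p)
    sum² = begin
      (x0 + x1) * (x0 + x1) + (y0 + y1) * (y0 + y1)
        ≡⟨ cong₂ _+_ (square (sumTo-*2 p f)) (square (sumTo-*2 p g)) ⟨
      sumTo n f * sumTo n f + sumTo n g * sumTo n g
        ≡⟨ complementary-sum-squares n (at-periodic A) (at-periodic B) compl ⟩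
      paf n f 0 + paf n g 0
        ≡⟨ pafs-at-zero ⟩
      + (4 ℕ.* p) ∎
    diff² : (x0 - x1) * (x0 - x1) + (y0 - y1) * (y0 - y1) ≡ + (4 ℕ.* p)
    diff² = begin
      (x0 - x1) * (x0 - x1) + (y0 - y1) * (y0 - y1)
        ≡⟨ cong₂ _+_ (square (sumTo-alternate-*2 p f)) (square (sumTo-alternate-*2 p g)) ⟨
      sumTo n (alternate f) * sumTo n (alternate f) + sumTo n (alternate g) * sumTo n (alternate g)
        ≡⟨ complementary-alternate-sum-squares p (at-periodic A) (at-periodic B) compl ⟩
      paf n f 0 + paf n g 0
        ≡⟨ pafs-at-zero ⟩
      + (4 ℕ.* p) ∎

open Compression using (seq2-η; normalForm; partner-normalForm; golay-compression-partner)
open PeriodicSums using (sumTo-*2)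
open import Data.Fin using (zero; suc)
open import Data.Nat using (ℕ; _*_)
open import Data.Nat.Primality using (Prime)
open import Data.Nat.Divisibility using (_∣_)
open import Data.Integer using (+_; _+_; _-_)
open import Data.Integer.Base using (_/_)
open import Data.Product using (_,_)
open import Relation.Binary.PropositionalEquality using (subst₂; sym)
open import Relation.Nullary using (¬_)

mainTheorem4 : (p : ℕ) → Prime p → ¬ (2 ∣ p) →
  (A B : Seq (p * 2)) → IsPeriodicGolayPair (p * 2) A B →
  let a = seqSum A
      b = seqSum B
  in Equiv (compress p 2 A , compress p 2 B)
           (seq2 ((a + b) / + 2) ((a - b) / + 2) , seq2 ((a + b) / + 2) ((b - a) / + 2))
mainTheorem4 p p-prime 2∤p A B golay =
  trans′ (pointwise (seq2-η (compress p 2 A)) (seq2-η (compress p 2 B)))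
         (subst₂ (λ a b → Equiv (seq2 x0 x1 , seq2 y0 y1) (normalForm a b))
                 (sym (sumTo-*2 p (at A))) (sym (sumTo-*2 p (at B)))
                 (partner-normalForm (golay-compression-partner p-prime 2∤p A B golay)))
  where
  x0 = compress p 2 A zero
  x1 = compress p 2 A (suc zero)
  y0 = compress p 2 B zero
  y1 = compress p 2 B (suc zero)
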